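{- The interpretability logic $\mathsf{ILR}$ is complete with respect to generalized Veltman semantics: for every modal formula $A$, if $A$ is valid on every generalized Veltman frame $(W,R,\{S_w:w\in W\})$ satisfying the condition $$(\mathsf{R})_{\mathsf{gen}}:\quad \text{for all } w,x,u\in W,\ V\subseteq W,\ \text{if } wRx,\ xRu,\ uS_wV, \text{ then for every } C\in\mathcal C(x,u) \text{ there is } U\subseteq V \text{ with } xS_wU \text{ and } R[U]\subseteq C,$$ where $\mathcal C(x,u)=\{C\subseteq R[x] : \text{for all } Z,\ uS_xZ \Rightarrow Z\cap C\neq\emptyset\}$, then $\mathsf{ILR}\vdash A$.
   Context: Modal formulas are built from a countable set of propositional variables, $\bot$, $\to$ and the binary connective $\rhd$; other Boolean connectives are abbreviations, $\Box A$ abbreviates $\neg A\rhd\bot$ and $\Diamond A$ abbreviates $\neg\Box\neg A$. The operator $\rhd$ binds weaker than the other connectives except $\to$. The logic $\mathsf{IL}$ has as axioms all instances of classical tautologies and of the schemata: $\Box(A\to B)\to(\Box A\to\Box B)$; $\Box(\Box A\to A)\to\Box A$; $\Box(A\to B)\to A\rhd B$; $(A\rhd B)\wedge(B\rhd C)\to A\rhd C$; $(A\rhd C)\wedge(B\rhd C)\to A\vee B\rhd C$; $A\rhd B\to(\Diamond A\to\Diamond B)$; $\Diamond A\rhd A$; its rules are modus ponens and necessitation. $\mathsf{ILR}$ is $\mathsf{IL}$ extended by all instances of $\mathsf{R}$: $A\rhd B\to\neg(A\rhd\neg C)\rhd B\wedge\Box C$. A generalized Veltman frame is $(W,R,\{S_w:w\in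 W\})$ with $W\neq\emptyset$, $R$ a transitive, conversely well-founded relation on $W$, and for each $w$, writing $R[w]=\{x:wRx\}$: (a) $S_w\subseteq R[w]\times(\mathcal P(R[w])\setminus\{\emptyset\})$; (b) $wRu$ implies $uS_w\{u\}$; (c) if $uS_wV$ and $vS_wZ_v$ for all $v\in V$ then $uS_w\bigcup_{v\in V}Z_v$; (d) if $wRu$ and $uRv$ then $uS_w\{v\}$; (e) if $uS_wV$ and $V\subseteq Z\subseteq R[w]$ then $uS_wZ$. For a set $U$, $R[U]=\bigcup_{v\in U}R[v]$. A generalized Veltman model adds a valuation; forcing is classical for Boolean connectives and $w\Vdash A\rhd B$ iff for every $u$ with $wRu$ and $u\Vdash A$ there is $V$ with $uS_wV$ and $v\Vdash B$ for all $v\in V$. A formula is valid on a frame if it is forced at every world of every model on that frame. -}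

module Defs where

open import Level using (Level; Lift; lift; 0ℓ) renaming (suc to lsuc)
open import Data.Nat using (ℕ)
open import Data.Bool using (Bool; true; false; not; _∨_)
open import Data.Empty using () renaming (⊥ to Empty)
open import Data.Product using (Σ; _×_; _,_)
open import Relation.Binary.PropositionalEquality using (_≡_)
open import Induction.WellFounded using (WellFounded)

infixr 5 _▷_
infixr 4 _⇒_

data Fm : Set where
  var : ℕ → Fm
  ⊥'  : Fm
  _⇒_ : Fm → Fm → Fm
  _▷_ : Fm → Fm → Fm

¬' : Fm → Fm
¬' A = A ⇒ ⊥'

⊤' : Fm
⊤' = ¬' ⊥'

_∨'_ : Fm → Fm → Fm
A ∨' B = ¬' A ⇒ B

_∧'_ : Fm → Fm → Fm
A ∧' B = ¬' (A ⇒ ¬' B)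

□ : Fm → Fm
□ A = ¬' A ▷ ⊥'

◇ : Fm → Fm
◇ A = ¬' (□ (¬' A))

-- Classical tautologies: formulas true under every Boolean valuation
-- of their maximal non-Boolean subformulas (variables and ▷-formulas).
-- These are exactly the substitution instances of propositional tautologies.

evalB : (Fm → Bool) → Fm → Bool
evalB v (var p) = v (var p)
evalB v ⊥'      = false
evalB v (A ⇒ B) = not (evalB v A) ∨ evalB v B
evalB v (A ▷ B) = v (A ▷ B)

Tautology : Fm → Set
Tautology A = (v : Fm → Bool) → evalB v A ≡ true

data ILR⊢ : Fm → Set where
  taut : ∀ {A} → Tautology A → ILR⊢ A
  axK  : ∀ {A B} → ILR⊢ (□ (A ⇒ B) ⇒ (□ A ⇒ □ B))
  axL  : ∀ {A} → ILR⊢ (□ (□ A ⇒ A) ⇒ □ A)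
  axJ1 : ∀ {A B} → ILR⊢ (□ (A ⇒ B) ⇒ A ▷ B)
  axJ2 : ∀ {A B C} → ILR⊢ ((A ▷ B) ∧' (B ▷ C) ⇒ A ▷ C)
  axJ3 : ∀ {A B C} → ILR⊢ ((A ▷ C) ∧' (B ▷ C) ⇒ (A ∨' B) ▷ C)
  axJ4 : ∀ {A B} → ILR⊢ (A ▷ B ⇒ (◇ A ⇒ ◇ B))
  axJ5 : ∀ {A} → ILR⊢ (◇ A ▷ A)
  axR  : ∀ {A B C} → ILR⊢ (A ▷ B ⇒ ¬' (A ▷ ¬' C) ▷ (B ∧' □ C))
  mp   : ∀ {A B} → ILR⊢ (A ⇒ B) → ILR⊢ A → ILR⊢ B
  nec  : ∀ {A} → ILR⊢ A → ILR⊢ (□ A)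

Subset : Set → Set₁
Subset W = W → Set

record GVFrame : Set₁ where
  field
    W     : Set
    R     : W → W → Set
    S     : W → W → Subset W → Set
    R-trans : ∀ {x y z} → R x y → R y z → R x z
    -- conversely well-founded: no infinite ascending R-chains
    R-cwf : WellFounded (λ y x → R x y)
    S-dom   : ∀ {w u V} → S w u V → R w u
    S-cod   : ∀ {w u V} → S w u V → ∀ v → V v → R w v
    S-nonempty : ∀ {w u V} → S w u V → Σ W V
    S-refl  : ∀ {w u} → R w u → S w u (λ x → x ≡ u)
    S-trans : ∀ {w u} {V : Subset W} → S w u V →
              (Z : (v : W) → V v → Subset W) →
              (∀ v (p : V v) → S w v (Z v p)) →
              S w u (λ x → Σ W λ v → Σ (V v) λ p → Z v p x)
    S-R     : ∀ {w u v} → R w u → R u v → S w u (λ x → x ≡ v)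
    S-mono  : ∀ {w u} {V Z : Subset W} → S w u V →
              (∀ x → V x → Z x) → (∀ x → Z x → R w x) → S w u Z

module _ (F : GVFrame) where
  open GVFrame F

  R[_] : Subset W → Subset W
  R[ U ] y = Σ W λ v → U v × R v y

  𝒞 : W → W → Subset W → Set₁
  𝒞 x u C = (∀ y → C y → R x y) ×
            (∀ (Z : Subset W) → S x u Z → Σ W λ z → Z z × C z)

  Rgen : Set₁
  Rgen = ∀ (w x u : W) (V : Subset W) → R w x → R x u → S w u V →
         ∀ (C : Subset W) → 𝒞 x u C →
         Σ (Subset W) λ U → (∀ y → U y → V y) × S w x U ×
                            (∀ y → R[ U ] y → C y)

  _,_⊩_ : (ℕ → W → Set) → W → Fm → Set₁
  val , w ⊩ var p = Lift (lsuc 0ℓ) (val p w)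
  val , w ⊩ ⊥'    = Lift (lsuc 0ℓ) Empty
  val , w ⊩ (A ⇒ B) = val , w ⊩ A → val , w ⊩ B
  val , w ⊩ (A ▷ B) = ∀ u → R w u → val , u ⊩ A →
                      Σ (Subset W) λ V → S w u V × (∀ v → V v → val , v ⊩ B)

  ValidOn : Fm → Set₁
  ValidOn A = ∀ (val : ℕ → W → Set) (w : W) → val , w ⊩ A

-- We follow the canonical-model method, relativised to the finite set 𝔈 of subformulas
-- of the formula A to be proved; classical reasoning (Lindenbaum's lemma, reading MCS as
-- Boolean functions, choosing labels) comes from the excluded-middle hypothesis.
--
-- Worlds are MCS; w R v when v inherits every □F of w
--     and gains some □¬E with E ∈ 𝔈, so R is conversely well-founded by counting.  A
--     label is a set S of formulas; E is S-critical at w when w ∋ E ▷ ¬G₁ ∨ … ∨ ¬Gₖ for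
--     some Gᵢ ∈ S, and v is an S-critical successor of w when w R v and v ∋ ¬E ∧ □¬E for
--     all such E.  Then w S u V means: for every label S for which u is an S-critical
--     successor of w, so is some member of V.
module Submission where

open import Defs
open import Level using (0ℓ; lift; lower) renaming (suc to lsuc)
open import Axiom.ExcludedMiddle using (ExcludedMiddle)
open import Data.Nat using (ℕ; zero; suc; _≤_; _<_; z≤n; s≤s; _⊔_; _∸_; _≤′_; ≤′-reflexive; ≤′-step)
open import Data.Nat.Properties using (m≤m⊔n; m≤n⊔m; ∸-monoʳ-<; m≤n⇒m≤1+n; ≤⇒≤′)
open import Data.Nat.Induction using (<-wellFounded)
open import Data.Bool using (Bool; true; false; not; _∨_; _∧_)
open import Data.Empty using (⊥-elim) renaming (⊥ to Empty)
open import Data.Unit using (tt) renaming (⊤ to Unit)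
open import Data.Product using (Σ; _×_; _,_; proj₁; proj₂)
open import Data.Sum using (_⊎_; inj₁; inj₂)
open import Data.Fin using (Fin) renaming (zero to fz; suc to fs)
open import Data.Vec using (Vec; []; _∷_; lookup)
import Data.Vec as Vec
open import Data.Vec.Properties using (lookup-map)
open import Data.List using (List; []; _∷_; _++_; map; length)
open import Data.List.Relation.Unary.All using (All; []; _∷_)
import Data.List.Relation.Unary.All as All
open import Data.List.Relation.Unary.All.Properties using (++⁺)
open import Data.List.Relation.Unary.Any using (here; there)
open import Data.List.Membership.Propositional using (_∈_)
open import Data.List.Membership.Propositional.Properties using (∈-++⁺ˡ; ∈-++⁺ʳ; ∈-map⁺)
open import Relation.Binary.PropositionalEquality using (_≡_; refl; sym; trans; subst)
open import Relation.Nullary using (¬_; Dec; yes; no)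
open import Relation.Nullary.Decidable using (map′; isYes)
open import Relation.Binary.Construct.On as On using ()
open import Induction.WellFounded using (WellFounded; module Subrelation)

data Schema (n : ℕ) : Set where
  at  : Fin n → Schema n
  ff  : Schema n
  _⊃_ : Schema n → Schema n → Schema n

infixr 4 _⊃_
infixl 6 _&_
infixl 5 _∣_

~ : ∀ {n} → Schema n → Schema n
~ t = t ⊃ ff

_∣_ : ∀ {n} → Schema n → Schema n → Schema n
t ∣ s = ~ t ⊃ s

_&_ : ∀ {n} → Schema n → Schema n → Schema n
t & s = ~ (t ⊃ ~ s)

a0 : ∀ {n} → Schema (suc n)
a0 = at fz
a1 : ∀ {n} → Schema (suc (suc n))
a1 = at (fs fz)
a2 : ∀ {n} → Schema (suc (suc (suc n)))
a2 = at (fs (fs fz))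
a3 : ∀ {n} → Schema (suc (suc (suc (suc n))))
a3 = at (fs (fs (fs fz)))
a4 : ∀ {n} → Schema (suc (suc (suc (suc (suc n)))))
a4 = at (fs (fs (fs (fs fz))))
a5 : ∀ {n} → Schema (suc (suc (suc (suc (suc (suc n))))))
a5 = at (fs (fs (fs (fs (fs fz)))))
a6 : ∀ {n} → Schema (suc (suc (suc (suc (suc (suc (suc n)))))))
a6 = at (fs (fs (fs (fs (fs (fs fz))))))
a7 : ∀ {n} → Schema (suc (suc (suc (suc (suc (suc (suc (suc n))))))))
a7 = at (fs (fs (fs (fs (fs (fs (fs fz)))))))

⟦_⟧ : ∀ {n} → Schema n → Vec Fm n → Fm
⟦ at i ⟧ σ = lookup σ i
⟦ ff ⟧ σ = ⊥'
⟦ t ⊃ s ⟧ σ = ⟦ t ⟧ σ ⇒ ⟦ s ⟧ σ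

evalSchema : ∀ {n} → Vec Bool n → Schema n → Bool
evalSchema ρ (at i) = lookup ρ i
evalSchema ρ ff = false
evalSchema ρ (t ⊃ s) = not (evalSchema ρ t) ∨ evalSchema ρ s

evalB-⟦⟧ : ∀ {n} (v : Fm → Bool) (σ : Vec Fm n) (t : Schema n) →
           evalB v (⟦ t ⟧ σ) ≡ evalSchema (Vec.map (evalB v) σ) t
evalB-⟦⟧ v σ (at i) = sym (lookup-map i (evalB v) σ)
evalB-⟦⟧ v σ ff = refl
evalB-⟦⟧ v σ (t ⊃ s) rewrite evalB-⟦⟧ v σ t | evalB-⟦⟧ v σ s = refl

everyValuation : (n : ℕ) → (Vec Bool n → Bool) → Bool
everyValuation zero f = f []
everyValuation (suc n) f = everyValuation n (λ ρ → f (true ∷ ρ)) ∧ everyValuation n (λ ρ → f (false ∷ ρ))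

∧-true-left : ∀ {a b} → a ∧ b ≡ true → a ≡ true
∧-true-left {true} p = refl

∧-true-right : ∀ {a b} → a ∧ b ≡ true → b ≡ true
∧-true-right {true} p = p

∨-true-split : ∀ {a b} → a ∨ b ≡ true → a ≡ true ⊎ b ≡ true
∨-true-split {true} p = inj₁ refl
∨-true-split {false} p = inj₂ p

∨-true-left : ∀ {a b} → a ≡ true → a ∨ b ≡ true
∨-true-left refl = refl

∨-true-right : ∀ {a b} → b ≡ true → a ∨ b ≡ true
∨-true-right {true} p = refl
∨-true-right {false} p = p

everyValuation-sound : ∀ n (f : Vec Bool n → Bool) → everyValuation n f ≡ true → ∀ ρ → f ρ ≡ true
everyValuation-sound zero f p [] = p
everyValuation-sound (suc n) f p (true ∷ ρ) = everyValuation-sound n _ (∧-true-left p) ρ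
everyValuation-sound (suc n) f p (false ∷ ρ) =
  everyValuation-sound n _ (∧-true-right {everyValuation n (λ ρ → f (true ∷ ρ))} p) ρ

⊢_ : Fm → Set
⊢ A = ILR⊢ A

tauto : ∀ {n} (t : Schema n) (σ : Vec Fm n) → everyValuation n (λ ρ → evalSchema ρ t) ≡ true → ⊢ ⟦ t ⟧ σ
tauto {n} t σ p = taut λ v →
  trans (evalB-⟦⟧ v σ t) (everyValuation-sound n (λ ρ → evalSchema ρ t) p (Vec.map (evalB v) σ))

⊢-id : ∀ {A} → ⊢ (A ⇒ A)
⊢-id {A} = tauto {1} (a0 ⊃ a0) (A ∷ []) refl

∧-fst : ∀ {A B} → ⊢ (A ∧' B ⇒ A)
∧-fst {A} {B} = tauto {2} ((a0 & a1) ⊃ a0) (A ∷ B ∷ []) refl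

∧-snd : ∀ {A B} → ⊢ (A ∧' B ⇒ B)
∧-snd {A} {B} = tauto {2} ((a0 & a1) ⊃ a1) (A ∷ B ∷ []) refl

¬¬-elim : ∀ {A} → ⊢ (¬' (¬' A) ⇒ A)
¬¬-elim {A} = tauto {1} (~ (~ a0) ⊃ a0) (A ∷ []) refl

ex-falso : ∀ {A} → ⊢ (⊥' ⇒ A)
ex-falso {A} = tauto {1} (ff ⊃ a0) (A ∷ []) refl

mp2 : ∀ {A B C} → ⊢ (A ⇒ B ⇒ C) → ⊢ A → ⊢ B → ⊢ C
mp2 p q r = mp (mp p q) r

⇒-trans : ∀ {A B C} → ⊢ (A ⇒ B) → ⊢ (B ⇒ C) → ⊢ (A ⇒ C)
⇒-trans {A} {B} {C} = mp2 (tauto {3} ((a0 ⊃ a1) ⊃ (a1 ⊃ a2) ⊃ (a0 ⊃ a2)) (A ∷ B ∷ C ∷ []) refl)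

⇒-swap : ∀ {A B C} → ⊢ (A ⇒ B ⇒ C) → ⊢ (B ⇒ A ⇒ C)
⇒-swap {A} {B} {C} = mp (tauto {3} ((a0 ⊃ a1 ⊃ a2) ⊃ (a1 ⊃ a0 ⊃ a2)) (A ∷ B ∷ C ∷ []) refl)

▷-trans : ∀ {A B C} → ⊢ (A ▷ B ⇒ B ▷ C ⇒ A ▷ C)
▷-trans {A} {B} {C} =
  mp (tauto {3} (((a0 & a1) ⊃ a2) ⊃ (a0 ⊃ a1 ⊃ a2)) ((A ▷ B) ∷ (B ▷ C) ∷ (A ▷ C) ∷ []) refl) axJ2

▷-∨ : ∀ {A B C} → ⊢ (A ▷ C ⇒ B ▷ C ⇒ (A ∨' B) ▷ C)
▷-∨ {A} {B} {C} =
  mp (tauto {3} (((a0 & a1) ⊃ a2) ⊃ (a0 ⊃ a1 ⊃ a2)) ((A ▷ C) ∷ (B ▷ C) ∷ ((A ∨' B) ▷ C) ∷ []) refl) axJ3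

▷-nec : ∀ {A B} → ⊢ (A ⇒ B) → ⊢ (A ▷ B)
▷-nec p = mp axJ1 (nec p)

▷-monoʳ : ∀ {A B C} → ⊢ (B ⇒ C) → ⊢ (A ▷ B ⇒ A ▷ C)
▷-monoʳ p = mp (⇒-swap ▷-trans) (▷-nec p)

▷-monoˡ : ∀ {A B C} → ⊢ (A ⇒ B) → ⊢ (B ▷ C ⇒ A ▷ C)
▷-monoˡ p = mp ▷-trans (▷-nec p)

□-mono : ∀ {A B} → ⊢ (A ⇒ B) → ⊢ (□ A ⇒ □ B)
□-mono p = mp axK (nec p)

□-∧ : ∀ {A B} → ⊢ (□ A ⇒ □ B ⇒ □ (A ∧' B))
□-∧ {A} {B} = ⇒-trans (□-mono (tauto {2} (a0 ⊃ a1 ⊃ (a0 & a1)) (A ∷ B ∷ []) refl)) axK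

-- Transitivity of □, derived from Löb's axiom as in GL.
□-4 : ∀ {A} → ⊢ (□ A ⇒ □ (□ A))
□-4 {A} = ⇒-trans (□-mono step) (⇒-trans axL (□-mono ∧-snd))
  where
  step : ⊢ (A ⇒ (□ (A ∧' □ A) ⇒ (A ∧' □ A)))
  step = mp (tauto {3} ((a1 ⊃ a2) ⊃ (a0 ⊃ (a1 ⊃ (a0 & a2)))) (A ∷ □ (A ∧' □ A) ∷ □ A ∷ []) refl)
            (□-mono ∧-fst)

▷⊥⇒□¬ : ∀ {A} → ⊢ (A ▷ ⊥' ⇒ □ (¬' A))
▷⊥⇒□¬ = ▷-monoˡ ¬¬-elim

□¬⇒▷ : ∀ {A B} → ⊢ (□ (¬' A) ⇒ A ▷ B)
□¬⇒▷ {A} = ⇒-trans (▷-monoˡ (tauto {1} (a0 ⊃ ~ (~ a0)) (A ∷ []) refl)) (▷-monoʳ ex-falso)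

▷-◇-absorb : ∀ {A} → ⊢ ((A ∨' ◇ A) ▷ A)
▷-◇-absorb = mp2 ▷-∨ (▷-nec ⊢-id) axJ5

-- The W-principle A ▷ A ∧ □¬A: pass to an R-maximal A-world, using Löb's axiom.
▷-W : ∀ {A} → ⊢ (A ▷ (A ∧' □ (¬' A)))
▷-W {A} = mp2 ▷-trans (▷-nec toMaximal) ▷-◇-absorb
  where
  C = A ∧' □ (¬' A)
  löb : ⊢ (□ (¬' C) ⇒ □ (¬' A))
  löb = ⇒-trans (□-mono (tauto {2} (~ (a0 & a1) ⊃ (a1 ⊃ ~ a0)) (A ∷ □ (¬' A) ∷ []) refl)) axL
  toMaximal : ⊢ (A ⇒ (C ∨' ◇ C))
  toMaximal = mp (tauto {3} ((a2 ⊃ a1) ⊃ (a0 ⊃ ((a0 & a1) ∣ ~ a2))) (A ∷ □ (¬' A) ∷ □ (¬' C) ∷ []) refl) löb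

conj : List Fm → Fm
conj [] = ⊤'
conj (G ∷ L) = G ∧' conj L

-- disj L is ¬G₁ ∨ … ∨ ¬Gₖ: the shape of the right-hand sides in critical formulas.
disj : List Fm → Fm
disj [] = ⊥'
disj (G ∷ L) = ¬' G ∨' disj L

conj-++ : ∀ L M → ⊢ (conj (L ++ M) ⇒ conj L ∧' conj M)
conj-++ [] M = tauto {1} (a0 ⊃ (~ ff & a0)) (conj M ∷ []) refl
conj-++ (G ∷ L) M = mp (tauto {4} ((a0 ⊃ (a1 & a2)) ⊃ ((a3 & a0) ⊃ ((a3 & a1) & a2)))
  (conj (L ++ M) ∷ conj L ∷ conj M ∷ G ∷ []) refl) (conj-++ L M)

conj-∈ : ∀ {G M} → G ∈ M → ⊢ (conj M ⇒ G)
conj-∈ (here refl) = ∧-fst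
conj-∈ (there p) = ⇒-trans ∧-snd (conj-∈ p)

conj-⊆ : ∀ L {M} → (∀ {G} → G ∈ L → G ∈ M) → ⊢ (conj M ⇒ conj L)
conj-⊆ [] {M} f = tauto {1} (a0 ⊃ ~ ff) (conj M ∷ []) refl
conj-⊆ (G ∷ L) {M} f = mp2 (tauto {3} ((a0 ⊃ a1) ⊃ (a0 ⊃ a2) ⊃ (a0 ⊃ (a1 & a2))) (conj M ∷ G ∷ conj L ∷ []) refl)
  (conj-∈ (f (here refl))) (conj-⊆ L (λ p → f (there p)))

disj-++ˡ : ∀ L M → ⊢ (disj L ⇒ disj (L ++ M))
disj-++ˡ [] M = ex-falso
disj-++ˡ (G ∷ L) M = mp (tauto {3} ((a1 ⊃ a2) ⊃ ((~ a0 ∣ a1) ⊃ (~ a0 ∣ a2))) (G ∷ disj L ∷ disj (L ++ M) ∷ []) refl)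
  (disj-++ˡ L M)

disj-++ʳ : ∀ L M → ⊢ (disj M ⇒ disj (L ++ M))
disj-++ʳ [] M = ⊢-id
disj-++ʳ (G ∷ L) M = mp (tauto {3} ((a1 ⊃ a2) ⊃ (a1 ⊃ (~ a0 ∣ a2))) (G ∷ disj M ∷ disj (L ++ M) ∷ []) refl)
  (disj-++ʳ L M)

-- An MCS is a Boolean characteristic function of a consistent and complete set; being
-- Bool-valued keeps the type of MCS in Set, as a frame carrier must be.
record IsMCS (Γ : Fm → Bool) : Set where
  field
    consistent : ∀ L → All (λ F → Γ F ≡ true) L → ¬ ⊢ (conj L ⇒ ⊥')
    complete   : ∀ F → Γ F ≡ true ⊎ Γ (¬' F) ≡ true

MCS : Set
MCS = Σ (Fm → Bool) IsMCS

_∋_ : MCS → Fm → Set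
w ∋ A = proj₁ w A ≡ true

_∌_ : MCS → Fm → Set
w ∌ A = proj₁ w A ≡ false

module _ (w : MCS) where
  open IsMCS (proj₂ w)

  ∋-derive : ∀ {L G} → All (w ∋_) L → ⊢ (conj L ⇒ G) → w ∋ G
  ∋-derive {L} {G} a p with complete G
  ... | inj₁ q = q
  ... | inj₂ q = ⊥-elim (consistent (¬' G ∷ L) (q ∷ a)
          (mp (tauto {2} ((a1 ⊃ a0) ⊃ ((~ a0 & a1) ⊃ ff)) (G ∷ conj L ∷ []) refl) p))

  ∋-thm : ∀ {A} → ⊢ A → w ∋ A
  ∋-thm {A} p = ∋-derive [] (mp (tauto {1} (a0 ⊃ (~ ff ⊃ a0)) (A ∷ []) refl) p)

  ∋-mp : ∀ {A B} → ⊢ (A ⇒ B) → w ∋ A → w ∋ B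
  ∋-mp {A} {B} p a = ∋-derive (a ∷ []) (mp (tauto {2} ((a0 ⊃ a1) ⊃ ((a0 & ~ ff) ⊃ a1)) (A ∷ B ∷ []) refl) p)

  ∋-mp2 : ∀ {A B C} → ⊢ (A ⇒ B ⇒ C) → w ∋ A → w ∋ B → w ∋ C
  ∋-mp2 {A} {B} {C} p a b = ∋-derive (a ∷ b ∷ [])
    (mp (tauto {3} ((a0 ⊃ a1 ⊃ a2) ⊃ ((a0 & (a1 & ~ ff)) ⊃ a2)) (A ∷ B ∷ C ∷ []) refl) p)

  ∋-contra : ∀ {A} → w ∋ A → w ∋ ¬' A → Empty
  ∋-contra {A} a b = consistent (A ∷ ¬' A ∷ []) (a ∷ b ∷ []) (tauto {1} ((a0 & (~ a0 & ~ ff)) ⊃ ff) (A ∷ []) refl)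

  ∌-⊥ : w ∋ ⊥' → Empty
  ∌-⊥ a = consistent (⊥' ∷ []) (a ∷ []) (tauto {0} ((ff & ~ ff) ⊃ ff) [] refl)

  ∋-complete : ∀ A → w ∋ A ⊎ w ∋ ¬' A
  ∋-complete = complete

  ∋-∌ : ∀ {A} → w ∋ A → w ∌ A → Empty
  ∋-∌ a e with trans (sym e) a
  ... | ()

  ¬∋⇒∌ : ∀ {A} → ¬ (w ∋ A) → w ∌ A
  ¬∋⇒∌ {A} n with proj₁ w A
  ... | true = ⊥-elim (n refl)
  ... | false = refl

  ∋-▷-join : ∀ {E Q S1 S0} → w ∋ (E ▷ disj S1) → w ∋ (Q ▷ disj S0) → w ∋ ((E ∨' Q) ▷ disj (S1 ++ S0))
  ∋-▷-join {S1 = S1} {S0} p q = ∋-mp2 ▷-∨ (∋-mp (▷-monoʳ (disj-++ˡ S1 S0)) p) (∋-mp (▷-monoʳ (disj-++ʳ S1 S0)) q)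

products : List Fm → List Fm → List Fm
products [] M = []
products (A ∷ L) M = map (A ⇒_) M ++ (map (A ▷_) M ++ products L M)

enum : ℕ → List Fm
enum zero = ⊥' ∷ []
enum (suc k) = enum k ++ (var k ∷ products (enum k) (enum k))

products-⇒ : ∀ {A B L M} → A ∈ L → B ∈ M → (A ⇒ B) ∈ products L M
products-⇒ {A} {L = A ∷ L} {M} (here refl) q = ∈-++⁺ˡ (∈-map⁺ (A ⇒_) q)
products-⇒ {L = C ∷ L} {M} (there p) q = ∈-++⁺ʳ (map (C ⇒_) M) (∈-++⁺ʳ (map (C ▷_) M) (products-⇒ p q))

products-▷ : ∀ {A B L M} → A ∈ L → B ∈ M → (A ▷ B) ∈ products L M
products-▷ {A} {L = A ∷ L} {M} (here refl) q = ∈-++⁺ʳ (map (A ⇒_) M) (∈-++⁺ˡ (∈-map⁺ (A ▷_) q))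
products-▷ {L = C ∷ L} {M} (there p) q = ∈-++⁺ʳ (map (C ⇒_) M) (∈-++⁺ʳ (map (C ▷_) M) (products-▷ p q))

enum-mono′ : ∀ {F k m} → k ≤′ m → F ∈ enum k → F ∈ enum m
enum-mono′ (≤′-reflexive refl) p = p
enum-mono′ (≤′-step q) p = ∈-++⁺ˡ (enum-mono′ q p)

enum-mono : ∀ {F k m} → k ≤ m → F ∈ enum k → F ∈ enum m
enum-mono q = enum-mono′ (≤⇒≤′ q)

rank : Fm → ℕ
rank (var n) = suc n
rank ⊥' = zero
rank (A ⇒ B) = suc (rank A ⊔ rank B)
rank (A ▷ B) = suc (rank A ⊔ rank B)

∈-enum : ∀ F → F ∈ enum (rank F)
∈-enum (var n) = ∈-++⁺ʳ (enum n) (here refl)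
∈-enum ⊥' = here refl
∈-enum (A ⇒ B) = ∈-++⁺ʳ (enum (rank A ⊔ rank B)) (there (products-⇒
  (enum-mono (m≤m⊔n (rank A) (rank B)) (∈-enum A)) (enum-mono (m≤n⊔m (rank A) (rank B)) (∈-enum B))))
∈-enum (A ▷ B) = ∈-++⁺ʳ (enum (rank A ⊔ rank B)) (there (products-▷
  (enum-mono (m≤m⊔n (rank A) (rank B)) (∈-enum A)) (enum-mono (m≤n⊔m (rank A) (rank B)) (∈-enum B))))

subformulas : Fm → List Fm
subformulas (var p) = var p ∷ []
subformulas ⊥' = ⊥' ∷ []
subformulas (A ⇒ B) = (A ⇒ B) ∷ (subformulas A ++ subformulas B)
subformulas (A ▷ B) = (A ▷ B) ∷ (subformulas A ++ subformulas B)

∈-subformulas : ∀ A → A ∈ subformulas A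
∈-subformulas (var p) = here refl
∈-subformulas ⊥' = here refl
∈-subformulas (A ⇒ B) = here refl
∈-subformulas (A ▷ B) = here refl

module Classical (lem : ExcludedMiddle (lsuc 0ℓ)) where

  dec : (P : Set) → Dec P
  dec P = map′ lower lift lem

  holds : Set → Bool
  holds P = isYes (dec P)

  holds-sound : ∀ {P : Set} → holds P ≡ true → P
  holds-sound {P} e with dec P
  ... | yes p = p

  holds-complete : ∀ {P : Set} → P → holds P ≡ true
  holds-complete {P} p with dec P
  ... | yes _ = refl
  ... | no ¬p = ⊥-elim (¬p p)

  module Lindenbaum (Δ : Fm → Set) (Δ-consistent : ∀ L → All Δ L → ¬ ⊢ (conj L ⇒ ⊥')) where

    Inconsistent : List Fm → Set
    Inconsistent M = Σ (List Fm) λ L → All Δ L × ⊢ (conj L ∧' conj M ⇒ ⊥')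

    Consistent : List Fm → Set
    Consistent M = ¬ Inconsistent M

    choose : ∀ {P : Set} → Dec P → Fm → List Fm → List Fm
    choose (yes _) F M = ¬' F ∷ M
    choose (no _) F M = F ∷ M

    decide : List Fm → Fm → List Fm
    decide M F = choose (dec (Inconsistent (F ∷ M))) F M

    -- If both M ∪ {F} and M ∪ {¬F} are inconsistent then so is M.
    choose-consistent : ∀ F M (d : Dec (Inconsistent (F ∷ M))) → Consistent M → Consistent (choose d F M)
    choose-consistent F M (no n) c = n
    choose-consistent F M (yes (L1 , q1 , p1)) c (L2 , q2 , p2) =
      c (L1 ++ L2 , ++⁺ q1 q2 ,
         mp (mp (mp (tauto {5} ((a0 ⊃ (a1 & a2)) ⊃ ((a1 & (a3 & a4)) ⊃ ff) ⊃ ((a2 & (~ a3 & a4)) ⊃ ff) ⊃ ((a0 & a4) ⊃ ff))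
            (conj (L1 ++ L2) ∷ conj L1 ∷ conj L2 ∷ F ∷ conj M ∷ []) refl) (conj-++ L1 L2)) p1) p2)

    choose-⊇ : ∀ {G} F M (d : Dec (Inconsistent (F ∷ M))) → G ∈ M → G ∈ choose d F M
    choose-⊇ F M (yes _) p = there p
    choose-⊇ F M (no _) p = there p

    choose-decides : ∀ F M (d : Dec (Inconsistent (F ∷ M))) → F ∈ choose d F M ⊎ ¬' F ∈ choose d F M
    choose-decides F M (yes _) = inj₂ (here refl)
    choose-decides F M (no _) = inj₁ (here refl)

    decideAll : List Fm → List Fm → List Fm
    decideAll M [] = M
    decideAll M (F ∷ Fs) = decideAll (decide M F) Fs

    decideAll-consistent : ∀ M Fs → Consistent M → Consistent (decideAll M Fs)
    decideAll-consistent M [] c = c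
    decideAll-consistent M (F ∷ Fs) c = decideAll-consistent (decide M F) Fs (choose-consistent F M _ c)

    decideAll-⊇ : ∀ {G} M Fs → G ∈ M → G ∈ decideAll M Fs
    decideAll-⊇ M [] p = p
    decideAll-⊇ M (F ∷ Fs) p = decideAll-⊇ (decide M F) Fs (choose-⊇ F M _ p)

    decideAll-decides : ∀ {F} M Fs → F ∈ Fs → F ∈ decideAll M Fs ⊎ ¬' F ∈ decideAll M Fs
    decideAll-decides {F} M (F ∷ Fs) (here refl) with choose-decides F M (dec (Inconsistent (F ∷ M)))
    ... | inj₁ p = inj₁ (decideAll-⊇ (decide M F) Fs p)
    ... | inj₂ p = inj₂ (decideAll-⊇ (decide M F) Fs p)
    decideAll-decides M (H ∷ Fs) (there q) = decideAll-decides (decide M H) Fs q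

    stage : ℕ → List Fm
    stage zero = []
    stage (suc k) = decideAll (stage k) (enum k)

    stage-consistent : ∀ k → Consistent (stage k)
    stage-consistent zero (L , a , p) =
      Δ-consistent L a (⇒-trans (tauto {1} (a0 ⊃ (a0 & ~ ff)) (conj L ∷ []) refl) p)
    stage-consistent (suc k) = decideAll-consistent (stage k) (enum k) (stage-consistent k)

    stage-mono′ : ∀ {G k m} → k ≤′ m → G ∈ stage k → G ∈ stage m
    stage-mono′ (≤′-reflexive refl) p = p
    stage-mono′ {m = suc m} (≤′-step q) p = decideAll-⊇ (stage m) (enum m) (stage-mono′ q p)

    stage-mono : ∀ {G k m} → k ≤ m → G ∈ stage k → G ∈ stage m
    stage-mono q = stage-mono′ (≤⇒≤′ q)

    stage-decides : ∀ F → F ∈ stage (suc (rank F)) ⊎ ¬' F ∈ stage (suc (rank F))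
    stage-decides F = decideAll-decides (stage (rank F)) (enum (rank F)) (∈-enum F)

    Γ : Fm → Bool
    Γ F = holds (Σ ℕ λ k → F ∈ stage k)

    common-stage : ∀ L → All (λ G → Γ G ≡ true) L → Σ ℕ λ K → ∀ {G} → G ∈ L → G ∈ stage K
    common-stage [] [] = zero , λ ()
    common-stage (G ∷ L) (g ∷ a) with holds-sound g | common-stage L a
    ... | (k , p) | (K , f) = k ⊔ K , λ { (here refl) → stage-mono (m≤m⊔n k K) p
                                        ; (there q) → stage-mono (m≤n⊔m k K) (f q) }

    Γ-decides : ∀ F → Γ F ≡ true ⊎ Γ (¬' F) ≡ true
    Γ-decides F with stage-decides F
    ... | inj₁ p = inj₁ (holds-complete (suc (rank F) , p))
    ... | inj₂ p = inj₂ (holds-complete (suc (rank F) , p))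

    Γ-MCS : IsMCS Γ
    IsMCS.consistent Γ-MCS L a p with common-stage L a
    ... | (K , f) = stage-consistent K ([] , [] ,
          ⇒-trans (tauto {1} ((~ ff & a0) ⊃ a0) (conj (stage K) ∷ []) refl) (⇒-trans (conj-⊆ L f) p))
    IsMCS.complete Γ-MCS = Γ-decides

    Δ⊆Γ : ∀ {F} → Δ F → Γ F ≡ true
    Δ⊆Γ {F} d with stage-decides F
    ... | inj₁ p = holds-complete (suc (rank F) , p)
    ... | inj₂ p = ⊥-elim (stage-consistent (suc (rank F)) (F ∷ [] , d ∷ [] ,
          mp (tauto {2} ((a1 ⊃ ~ a0) ⊃ ((a0 & ~ ff) & a1) ⊃ ff) (F ∷ conj (stage (suc (rank F))) ∷ []) refl)
             (conj-∈ p)))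

    lindenbaum : Σ MCS λ w → ∀ {F} → Δ F → w ∋ F
    lindenbaum = (Γ , Γ-MCS) , Δ⊆Γ

  copies-¬ : ∀ A L → All (_≡ ¬' A) L → ⊢ (¬' A ⇒ conj L)
  copies-¬ A [] [] = tauto {1} (~ a0 ⊃ ~ ff) (A ∷ []) refl
  copies-¬ A (G ∷ L) (refl ∷ gs) =
    mp (tauto {2} ((~ a0 ⊃ a1) ⊃ (~ a0 ⊃ (~ a0 & a1))) (A ∷ conj L ∷ []) refl) (copies-¬ A L gs)

  refuting-MCS : ∀ {A} → ¬ ⊢ A → Σ MCS λ w → w ∋ ¬' A
  refuting-MCS {A} ⊬A = proj₁ lindenbaum , proj₂ lindenbaum refl
    where
    ¬A-consistent : ∀ L → All (_≡ ¬' A) L → ¬ ⊢ (conj L ⇒ ⊥')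
    ¬A-consistent L a incons =
      ⊬A (mp (tauto {1} ((~ a0 ⊃ ff) ⊃ a0) (A ∷ []) refl) (⇒-trans (copies-¬ A L a) incons))
    open Lindenbaum (_≡ ¬' A) ¬A-consistent using (lindenbaum)

  module Canonical (𝔈 : List Fm) where

    record R (w v : MCS) : Set where
      constructor mkR
      field
        inherits : ∀ F → w ∋ □ F → (v ∋ F) × (v ∋ □ F)
        gains    : Σ Fm λ E → (E ∈ 𝔈) × (v ∋ □ (¬' E)) × (w ∌ □ (¬' E))

    R-trans : ∀ {x y z} → R x y → R y z → R x z
    R-trans {x} {y} {z} (mkR xy _) (mkR yz (E , e , zE , yE)) = mkR
      (λ F p → yz F (proj₂ (xy F p)))
      (E , e , zE , ¬∋⇒∌ x (λ p → ∋-∌ y (proj₂ (xy _ p)) yE))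

    boxCount : MCS → List Fm → ℕ
    boxCount w [] = 0
    boxCount w (E ∷ L) with proj₁ w (□ (¬' E))
    ... | true = suc (boxCount w L)
    ... | false = boxCount w L

    BoxesIncluded : MCS → MCS → List Fm → Set
    BoxesIncluded w v L = ∀ {E} → E ∈ L → w ∋ □ (¬' E) → v ∋ □ (¬' E)

    boxCount-≤ : ∀ w L → boxCount w L ≤ length L
    boxCount-≤ w [] = z≤n
    boxCount-≤ w (E ∷ L) with proj₁ w (□ (¬' E))
    ... | true = s≤s (boxCount-≤ w L)
    ... | false = m≤n⇒m≤1+n (boxCount-≤ w L)

    boxCount-mono : ∀ w v L → BoxesIncluded w v L → boxCount w L ≤ boxCount v L
    boxCount-mono w v [] f = z≤n
    boxCount-mono w v (E ∷ L) f with proj₁ w (□ (¬' E)) in eqw | proj₁ v (□ (¬' E)) in eqv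
    ... | true | true = s≤s (boxCount-mono w v L (λ p → f (there p)))
    ... | true | false = ⊥-elim (∋-∌ v (f (here refl) eqw) eqv)
    ... | false | true = m≤n⇒m≤1+n (boxCount-mono w v L (λ p → f (there p)))
    ... | false | false = boxCount-mono w v L (λ p → f (there p))

    boxCount-strict : ∀ w v L → BoxesIncluded w v L → ∀ {E} → E ∈ L →
                      v ∋ □ (¬' E) → w ∌ □ (¬' E) → boxCount w L < boxCount v L
    boxCount-strict w v (E ∷ L) f (here refl) vE wE with proj₁ w (□ (¬' E)) | proj₁ v (□ (¬' E))
    boxCount-strict w v (E ∷ L) f (here refl) refl refl | false | true = s≤s (boxCount-mono w v L (λ p → f (there p)))
    boxCount-strict w v (H ∷ L) f (there e) vE wE with proj₁ w (□ (¬' H)) in eqw | proj₁ v (□ (¬' H)) in eqv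
    ... | true | true = s≤s (boxCount-strict w v L (λ p → f (there p)) e vE wE)
    ... | true | false = ⊥-elim (∋-∌ v (f (here refl) eqw) eqv)
    ... | false | true = m≤n⇒m≤1+n (boxCount-strict w v L (λ p → f (there p)) e vE wE)
    ... | false | false = boxCount-strict w v L (λ p → f (there p)) e vE wE

    missing : MCS → ℕ
    missing w = length 𝔈 ∸ boxCount w 𝔈

    R-decreases : ∀ {w v} → R w v → missing v < missing w
    R-decreases {w} {v} (mkR inh (E , e , vE , wE)) =
      ∸-monoʳ-< (boxCount-strict w v 𝔈 (λ _ p → proj₂ (inh _ p)) e vE wE) (boxCount-≤ v 𝔈)

    R-cwf : WellFounded (λ y x → R x y)
    R-cwf = Subrelation.wellFounded R-decreases (On.wellFounded missing <-wellFounded)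

    Label : Set
    Label = Fm → Bool

    Critical : MCS → Label → Fm → Set
    Critical w S E = Σ (List Fm) λ S0 → All (λ G → S G ≡ true) S0 × (w ∋ (E ▷ disj S0))

    CritSucc : Label → MCS → MCS → Set
    CritSucc S w v = R w v × (∀ E → Critical w S E → (v ∋ ¬' E) × (v ∋ □ (¬' E)))

    SC : MCS → MCS → (MCS → Set) → Set
    SC w u V = R w u × (∀ v → V v → R w v) × (∀ (S : Label) → CritSucc S w u → Σ MCS λ v → V v × CritSucc S w v)

    -- Every R-successor is a critical successor for the empty label.
    SC-nonempty : ∀ {w u V} → SC w u V → Σ MCS V
    SC-nonempty {w} {u} (wu , _ , realise) with realise (λ _ → false) (wu , emptyLabel)
      where
      emptyLabel : ∀ E → Critical w (λ _ → false) E → (u ∋ ¬' E) × (u ∋ □ (¬' E))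
      emptyLabel E ([] , [] , p) = R.inherits wu (¬' E) (∋-mp w ▷⊥⇒□¬ p)
      emptyLabel E (_ ∷ _ , () ∷ _ , _)
    ... | v , Vv , _ = v , Vv

    SC-refl : ∀ {w u} → R w u → SC w u (λ x → x ≡ u)
    SC-refl {w} {u} r = r , (λ x eq → subst (R w) (sym eq) r) , λ S p → u , refl , p

    SC-trans : ∀ {w u} {V : MCS → Set} → SC w u V → (Z : (v : MCS) → V v → MCS → Set) →
               (∀ v (p : V v) → SC w v (Z v p)) → SC w u (λ x → Σ MCS λ v → Σ (V v) λ p → Z v p x)
    SC-trans {w} {u} {V} (wu , _ , realiseV) Z sZ =
      wu , (λ { x (v , p , z) → proj₁ (proj₂ (sZ v p)) x z }) , realise
      where
      realise : ∀ S → CritSucc S w u → Σ MCS λ x → (Σ MCS λ v → Σ (V v) λ p → Z v p x) × CritSucc S w x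
      realise S cu with realiseV S cu
      ... | v , p , cv with proj₂ (proj₂ (sZ v p)) S cv
      ... | x , z , cx = x , (v , p , z) , cx

    -- An R-successor v of u realises every label u realises, as u ∋ □¬E passes to v.
    SC-R : ∀ {w u v} → R w u → R u v → SC w u (λ x → x ≡ v)
    SC-R {w} {u} {v} wu uv = wu , (λ x eq → subst (R w) (sym eq) (R-trans wu uv)) ,
      λ S cu → v , refl , (R-trans wu uv , λ E cE → R.inherits uv (¬' E) (proj₂ (proj₂ cu E cE)))

    SC-mono : ∀ {w u} {V Z : MCS → Set} → SC w u V → (∀ x → V x → Z x) → (∀ x → Z x → R w x) → SC w u Z
    SC-mono (wu , _ , realise) V⊆Z Z⊆R = wu , Z⊆R , λ S cu →
      let (v , Vv , cv) = realise S cu in v , V⊆Z _ Vv , cv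

    frame : GVFrame
    frame = record
      { W = MCS ; R = R ; S = SC ; R-trans = R-trans ; R-cwf = R-cwf
      ; S-dom = proj₁ ; S-cod = λ s → proj₁ (proj₂ s) ; S-nonempty = SC-nonempty
      ; S-refl = SC-refl ; S-trans = SC-trans ; S-R = SC-R ; S-mono = SC-mono }

    module Existence (w : MCS) (S : Label) (A : Fm) (A-noncritical : ¬ Critical w S A) where

      Base : Fm
      Base = A ∧' □ (¬' A)

      Δ : Fm → Set
      Δ G = (G ≡ Base) ⊎ ((Σ Fm λ F → (G ≡ F ∧' □ F) × (w ∋ □ F))
                        ⊎ (Σ Fm λ E → (G ≡ ¬' E ∧' □ (¬' E)) × Critical w S E))

      -- A finite part L of Δ follows from Base, one boxed formula P ∧ □P with w ∋ □P
      -- (the conjunction of the inherited ones) and ¬Q ∧ □¬Q for one S-critical Q (the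
      -- disjunction of the critical ones).
      Bounded : List Fm → Set
      Bounded L = Σ Fm λ P → Σ Fm λ Q → Σ (List Fm) λ S0 →
        All (λ G → S G ≡ true) S0 × (w ∋ □ P) × (w ∋ (Q ▷ disj S0)) ×
        ⊢ (Base ∧' ((P ∧' □ P) ∧' (¬' Q ∧' □ (¬' Q))) ⇒ conj L)

      bounded : ∀ L → All Δ L → Bounded L
      bounded [] [] = ⊤' , ⊥' , [] , [] , ∋-thm w (nec (tauto {0} (~ ff) [] refl)) ,
        ∋-thm w (▷-nec ⊢-id) , tauto {1} (a0 ⊃ ~ ff) ((Base ∧' ((⊤' ∧' □ ⊤') ∧' (¬' ⊥' ∧' □ (¬' ⊥')))) ∷ []) refl
      bounded (G ∷ L) (inj₁ refl ∷ a) with bounded L a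
      ... | P , Q , S0 , s0 , bP , qS , pr = P , Q , S0 , s0 , bP , qS ,
            mp (tauto {4} (((a0 & (a1 & a2)) ⊃ a3) ⊃ ((a0 & (a1 & a2)) ⊃ (a0 & a3)))
               (Base ∷ (P ∧' □ P) ∷ (¬' Q ∧' □ (¬' Q)) ∷ conj L ∷ []) refl) pr
      bounded (G ∷ L) (inj₂ (inj₁ (F , refl , bF)) ∷ a) with bounded L a
      ... | P , Q , S0 , s0 , bP , qS , pr = (F ∧' P) , Q , S0 , s0 , ∋-mp2 w □-∧ bF bP , qS ,
            mp (mp (mp (tauto {8} ((a5 ⊃ a3) ⊃ (a5 ⊃ a4) ⊃ ((a0 & ((a2 & a4) & a6)) ⊃ a7) ⊃
                                   ((a0 & (((a1 & a2) & a5) & a6)) ⊃ ((a1 & a3) & a7)))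
               (Base ∷ F ∷ P ∷ □ F ∷ □ P ∷ □ (F ∧' P) ∷ (¬' Q ∧' □ (¬' Q)) ∷ conj L ∷ []) refl)
               (□-mono ∧-fst)) (□-mono ∧-snd)) pr
      bounded (G ∷ L) (inj₂ (inj₂ (E , refl , (S1 , s1 , cE))) ∷ a) with bounded L a
      ... | P , Q , S0 , s0 , bP , qS , pr = P , (E ∨' Q) , (S1 ++ S0) , ++⁺ s1 s0 , bP , ∋-▷-join w cE qS ,
            mp (mp (mp (tauto {8} ((a7 ⊃ a6) ⊃ (a7 ⊃ a3) ⊃ ((a0 & (a1 & (~ a2 & a3))) ⊃ a4) ⊃
                                   ((a0 & (a1 & (~ (a5 ∣ a2) & a7))) ⊃ ((~ a5 & a6) & a4)))
               (Base ∷ (P ∧' □ P) ∷ Q ∷ □ (¬' Q) ∷ conj L ∷ E ∷ □ (¬' E) ∷ □ (¬' (E ∨' Q)) ∷ []) refl)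
               (□-mono (tauto {2} (~ (a0 ∣ a1) ⊃ ~ a0) (E ∷ Q ∷ []) refl)))
               (□-mono (tauto {2} (~ (a0 ∣ a1) ⊃ ~ a1) (E ∷ Q ∷ []) refl))) pr

      -- If Δ were inconsistent then □(P ∧ □P) would give Base ▷ Q ∨ ◇Q, hence
      -- A ▷ Base ▷ Q ▷ ⋁S0 by W and J5: A would be S-critical.
      Δ-consistent : ∀ L → All Δ L → ¬ ⊢ (conj L ⇒ ⊥')
      Δ-consistent L a incons with bounded L a
      ... | P , Q , S0 , s0 , bP , qS , pr =
        A-noncritical (S0 , s0 , ∋-mp2 w ▷-trans (∋-thm w ▷-W)
          (∋-mp2 w ▷-trans Base▷Q (∋-mp2 w ▷-trans (∋-thm w ▷-◇-absorb) qS)))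
        where
        refute : ⊢ ((P ∧' □ P) ⇒ (Base ⇒ (Q ∨' ◇ Q)))
        refute = mp (tauto {4} (((a0 & (a1 & (~ a2 & a3))) ⊃ ff) ⊃ (a1 ⊃ (a0 ⊃ (a2 ∣ ~ a3))))
                    (Base ∷ (P ∧' □ P) ∷ Q ∷ □ (¬' Q) ∷ []) refl) (⇒-trans pr incons)
        Base▷Q : w ∋ (Base ▷ (Q ∨' ◇ Q))
        Base▷Q = ∋-mp w axJ1 (∋-mp w (□-mono refute) (∋-mp2 w □-∧ bP (∋-mp w □-4 bP)))

      open Lindenbaum Δ Δ-consistent using (lindenbaum)

      v : MCS
      v = proj₁ lindenbaum

      v⊇Δ : ∀ {F} → Δ F → v ∋ F
      v⊇Δ = proj₂ lindenbaum

      v∋both : ∀ {F G} → Δ (F ∧' G) → (v ∋ F) × (v ∋ G)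
      v∋both d = ∋-mp v ∧-fst (v⊇Δ d) , ∋-mp v ∧-snd (v⊇Δ d)

      -- v gains □¬A, which w lacks because A is not even ∅-critical at w.
      w-R-v : A ∈ 𝔈 → R w v
      w-R-v e = mkR (λ F bF → v∋both (inj₂ (inj₁ (F , refl , bF))))
        (A , e , proj₂ (v∋both (inj₁ refl)) , ¬∋⇒∌ w (λ p → A-noncritical ([] , [] , ∋-mp w □¬⇒▷ p)))

      successor : A ∈ 𝔈 → Σ MCS λ v → (v ∋ A) × CritSucc S w v
      successor e = v , proj₁ (v∋both (inj₁ refl)) , w-R-v e , λ E cE → v∋both (inj₂ (inj₂ (E , refl , cE)))

    -- Only the statement of the existence lemma is needed later; keeping it abstract
    -- stops the type checker from unfolding the Lindenbaum construction.
    abstract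
      existence : ∀ w S A → A ∈ 𝔈 → ¬ Critical w S A → Σ MCS λ v → (v ∋ A) × CritSucc S w v
      existence w S A e nc = Existence.successor w S A nc e

    val : ℕ → MCS → Set
    val p w = w ∋ var p

    _⊩_ : MCS → Fm → Set₁
    w ⊩ A = _,_⊩_ frame val w A

    Truth : Fm → Set₁
    Truth A = ∀ w → (w ∋ A → w ⊩ A) × (w ⊩ A → w ∋ A)

    truth-⇒ : ∀ {A B} → Truth A → Truth B → Truth (A ⇒ B)
    truth-⇒ {A} {B} tA tB w = forward , backward
      where
      forward : w ∋ (A ⇒ B) → w ⊩ (A ⇒ B)
      forward p fA = proj₁ (tB w) (∋-mp2 w (tauto {2} ((a0 ⊃ a1) ⊃ a0 ⊃ a1) (A ∷ B ∷ []) refl) p (proj₂ (tA w) fA))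
      backward : w ⊩ (A ⇒ B) → w ∋ (A ⇒ B)
      backward f with ∋-complete w A
      ... | inj₁ a = ∋-mp w (tauto {2} (a1 ⊃ (a0 ⊃ a1)) (A ∷ B ∷ []) refl) (proj₂ (tB w) (f (proj₁ (tA w) a)))
      ... | inj₂ na = ∋-mp w (tauto {2} (~ a0 ⊃ (a0 ⊃ a1)) (A ∷ B ∷ []) refl) na

    -- If w ∋ A ▷ B and u ∋ A is an R-successor of w, the successors of w containing B
    -- realise every label u realises: were B S-critical, A would be too, contradicting
    -- u ∋ A; otherwise the existence lemma applies.
    ▷-realise : ∀ {w u A B} → B ∈ 𝔈 → w ∋ (A ▷ B) → u ∋ A →
                ∀ S → CritSucc S w u → Σ MCS λ v → (R w v × (v ∋ B)) × CritSucc S w v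
    ▷-realise {w} {u} {A} {B} B∈𝔈 p uA S cu with dec (Critical w S B)
    ... | yes (S0 , s0 , q) = ⊥-elim (∋-contra u uA (proj₁ (proj₂ cu A (S0 , s0 , ∋-mp2 w ▷-trans p q))))
    ... | no nc with existence w S B B∈𝔈 nc
    ... | v , vB , cv = v , (proj₁ cv , vB) , cv

    truth-▷-forward : ∀ {A B} → B ∈ 𝔈 → Truth A → Truth B → ∀ w → w ∋ (A ▷ B) → w ⊩ (A ▷ B)
    truth-▷-forward {A} {B} B∈𝔈 tA tB w p u wu fA =
      (λ v → R w v × (v ∋ B)) , (wu , (λ v → proj₁) , ▷-realise B∈𝔈 p (proj₂ (tA u) fA)) ,
      λ v q → proj₁ (tB v) (proj₂ q)

    -- The label {¬B}; E is {¬B}-critical at w exactly when w ∋ E ▷ B.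
    labelNeg : Fm → Label
    labelNeg B G = holds (G ≡ ¬' B)

    disj-labelNeg : ∀ B S0 → All (λ G → labelNeg B G ≡ true) S0 → ⊢ (disj S0 ⇒ B)
    disj-labelNeg B [] [] = ex-falso
    disj-labelNeg B (G ∷ S0) (g ∷ gs) with holds-sound g
    ... | refl = mp (tauto {2} ((a1 ⊃ a0) ⊃ ((~ (~ a0) ∣ a1) ⊃ a0)) (B ∷ disj S0 ∷ []) refl) (disj-labelNeg B S0 gs)

    labelNeg-critical : ∀ w {E B} → Critical w (labelNeg B) E → w ∋ (E ▷ B)
    labelNeg-critical w {B = B} (S0 , s0 , q) = ∋-mp w (▷-monoʳ (disj-labelNeg B S0 s0)) q

    labelNeg-self : ∀ w B → Critical w (labelNeg B) B
    labelNeg-self w B = (¬' B ∷ []) , holds-complete refl ∷ [] ,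
      ∋-thm w (▷-nec (tauto {1} (a0 ⊃ (~ (~ a0) ∣ ff)) (B ∷ []) refl))

    -- If w ∌ A ▷ B, A is not {¬B}-critical; existence yields an A-successor u critical
    -- for {¬B}.  Forcing gives B-worlds V with w S u V, and one of them is critical for
    -- {¬B}, so it contains ¬B as B is {¬B}-critical: a contradiction.
    truth-▷-backward : ∀ {A B} → A ∈ 𝔈 → Truth A → Truth B → ∀ w → w ⊩ (A ▷ B) → w ∋ (A ▷ B)
    truth-▷-backward {A} {B} A∈𝔈 tA tB w f with ∋-complete w (A ▷ B)
    ... | inj₁ q = q
    ... | inj₂ n with existence w (labelNeg B) A A∈𝔈 (λ c → ∋-contra w (labelNeg-critical w c) n)
    ... | u , uA , cu with f u (proj₁ cu) (proj₁ (tA u) uA)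
    ... | V , (_ , _ , realise) , V⊩B with realise (labelNeg B) cu
    ... | v , Vv , cv = ⊥-elim (∋-contra v (proj₂ (tB v) (V⊩B v Vv)) (proj₁ (proj₂ cv B (labelNeg-self w B))))

    Covered : Fm → Set
    Covered (var p) = Unit
    Covered ⊥' = Unit
    Covered (A ⇒ B) = Covered A × Covered B
    Covered (A ▷ B) = (A ∈ 𝔈) × (B ∈ 𝔈) × Covered A × Covered B

    truth : ∀ A → Covered A → Truth A
    truth (var p) _ w = lift , lower
    truth ⊥' _ w = (λ p → ⊥-elim (∌-⊥ w p)) , λ { (lift ()) }
    truth (A ⇒ B) (cA , cB) = truth-⇒ (truth A cA) (truth B cB)
    truth (A ▷ B) (A∈𝔈 , B∈𝔈 , cA , cB) w =
      truth-▷-forward B∈𝔈 (truth A cA) (truth B cB) w , truth-▷-backward A∈𝔈 (truth A cA) (truth B cB) w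

    covered : ∀ C → (∀ {Y} → Y ∈ subformulas C → Y ∈ 𝔈) → Covered C
    covered (var p) f = tt
    covered ⊥' f = tt
    covered (A ⇒ B) f =
      covered A (λ q → f (there (∈-++⁺ˡ q))) , covered B (λ q → f (there (∈-++⁺ʳ (subformulas A) q)))
    covered (A ▷ B) f =
      f (there (∈-++⁺ˡ (∈-subformulas A))) , f (there (∈-++⁺ʳ (subformulas A) (∈-subformulas B))) ,
      covered A (λ q → f (there (∈-++⁺ˡ q))) , covered B (λ q → f (there (∈-++⁺ʳ (subformulas A) q)))

    -- A set C ∈ 𝒞(x,u) contains all χ-critical successors of x, for some label χ for
    -- which u is χ-critical.  Otherwise, for every such χ, some χ-critical successor of x
    -- avoids C; so x S u (R[x] ∖ C), contradicting C ∈ 𝒞(x,u).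
    labelFor𝒞 : ∀ x u → R x u → (C : MCS → Set) → 𝒞 frame x u C →
                Σ Label λ χ → CritSucc χ x u × (∀ z → CritSucc χ x z → C z)
    labelFor𝒞 x u xu C (_ , meetsC) with dec (Σ Label λ χ → CritSucc χ x u × (∀ z → CritSucc χ x z → C z))
    ... | yes found = found
    ... | no none = ⊥-elim (outside (meetsC avoidC (xu , (λ z → proj₁) , escape)))
      where
      avoidC : MCS → Set
      avoidC z = R x z × ¬ C z
      escape : ∀ χ → CritSucc χ x u → Σ MCS λ z → avoidC z × CritSucc χ x z
      escape χ cu with dec (Σ MCS λ z → avoidC z × CritSucc χ x z)
      ... | yes e = e
      ... | no ne = ⊥-elim (none (χ , cu , λ z cz → inC z cz (dec (C z))))
        where
        inC : ∀ z → CritSucc χ x z → Dec (C z) → C z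
        inC z cz (yes c) = c
        inC z cz (no nc) = ⊥-elim (ne (z , (proj₁ cz , nc) , cz))
      outside : (Σ MCS λ z → avoidC z × C z) → Empty
      outside (z , (_ , nc) , c) = nc c

    -- The witness for (R)_gen: U = {v ∈ V : R[v] ⊆ C}.  For a label S realised by x we
    -- extend S by the formulas □¬E with E χ-critical at x; axiom R shows that u realises
    -- the extended label, and its realiser in V inherits enough boxes to lie in U.
    module RgenWitness (w x u : MCS) (V : MCS → Set) (wx : R w x) (xu : R x u) (sV : SC w u V)
                       (χ : Label) (cu : CritSucc χ x u) where

      boxedCritical : Label
      boxedCritical G = holds (Σ Fm λ E → (G ≡ □ (¬' E)) × Critical x χ E)

      extend : Label → Label
      extend S G = S G ∨ boxedCritical G

      split : ∀ S S0' → All (λ G → extend S G ≡ true) S0' →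
              Σ (List Fm) λ S0 → Σ (List Fm) λ X0 → All (λ G → S G ≡ true) S0 ×
              All (λ G → boxedCritical G ≡ true) X0 × ⊢ (disj S0' ⇒ (disj S0 ∨' disj X0))
      split S [] [] = [] , [] , [] , [] , tauto {0} (ff ⊃ (ff ∣ ff)) [] refl
      split S (G ∷ S0') (g ∷ gs) with split S S0' gs | ∨-true-split {S G} g
      ... | S0 , X0 , a , b , pr | inj₁ sG = (G ∷ S0) , X0 , sG ∷ a , b ,
            mp (tauto {4} ((a1 ⊃ (a2 ∣ a3)) ⊃ ((~ a0 ∣ a1) ⊃ ((~ a0 ∣ a2) ∣ a3))) (G ∷ disj S0' ∷ disj S0 ∷ disj X0 ∷ []) refl) pr
      ... | S0 , X0 , a , b , pr | inj₂ xG = S0 , (G ∷ X0) , a , xG ∷ b ,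
            mp (tauto {4} ((a1 ⊃ (a2 ∣ a3)) ⊃ ((~ a0 ∣ a1) ⊃ (a2 ∣ (~ a0 ∣ a3))))  (G ∷ disj S0' ∷ disj S0 ∷ disj X0 ∷ []) refl) pr

      boxedCritical-bound : ∀ X0 → All (λ G → boxedCritical G ≡ true) X0 →
        Σ Fm λ K → Σ (List Fm) λ χs → All (λ G → χ G ≡ true) χs × ⊢ (□ K ⇒ ¬' (disj X0)) × (x ∋ (¬' K ▷ disj χs))
      boxedCritical-bound [] [] = ⊤' , [] , [] , tauto {1} (a0 ⊃ ~ ff) (□ ⊤' ∷ []) refl , ∋-thm x (▷-nec ¬¬-elim)
      boxedCritical-bound (G ∷ X0) (g ∷ gs) with holds-sound g | boxedCritical-bound X0 gs
      ... | (E , refl , (χ1 , c1 , q1)) | (K , χs , cs , bK , qK) =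
            (¬' E ∧' K) , (χ1 ++ χs) , ++⁺ c1 cs ,
            mp (mp (mp (tauto {4} ((a0 ⊃ a1) ⊃ (a0 ⊃ a2) ⊃ (a2 ⊃ ~ a3) ⊃ (a0 ⊃ ~ (~ a1 ∣ a3)))
                  (□ (¬' E ∧' K) ∷ □ (¬' E) ∷ □ K ∷ disj X0 ∷ []) refl) (□-mono ∧-fst)) (□-mono ∧-snd)) bK ,
            ∋-mp x (▷-monoˡ (tauto {2} (~ (~ a0 & a1) ⊃ (a0 ∣ ~ a1)) (E ∷ K ∷ []) refl)) (∋-▷-join x q1 qK)

      -- The key step, using axiom R: if E is (extend S)-critical at w and S is realised by
      -- x, then E ∨ ◇E is χ-critical at x, hence u ∋ ¬(E ∨ ◇E).
      lift-critical : ∀ S → CritSucc S w x → ∀ E → Critical w (extend S) E → Critical x χ (E ∨' ◇ E)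
      lift-critical S (_ , cx) E (S0' , s0' , p) with split S S0' s0'
      ... | S0 , X0 , sS , sX , sp with boxedCritical-bound X0 sX
      ... | K , χs , cχ , bK , xK = χs , cχ , ∋-mp2 x ▷-trans E*▷¬K xK
        where
        E* = E ∨' ◇ E
        viaR : w ∋ (¬' (E* ▷ ¬' K) ▷ ((disj S0 ∨' disj X0) ∧' □ K))
        viaR = ∋-mp w axR (∋-mp w (▷-monoʳ sp) (∋-mp2 w ▷-∨ p (∋-mp2 w ▷-trans (∋-thm w axJ5) p)))
        S-critical : Critical w S (¬' (E* ▷ ¬' K))
        S-critical = S0 , sS ,
          ∋-mp w (▷-monoʳ (mp (tauto {3} ((a2 ⊃ ~ a1) ⊃ (((a0 ∣ a1) & a2) ⊃ a0)) (disj S0 ∷ disj X0 ∷ □ K ∷ []) refl) bK)) viaR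
        E*▷¬K : x ∋ (E* ▷ ¬' K)
        E*▷¬K = ∋-mp x ¬¬-elim (proj₁ (cx _ S-critical))

      u-realises : ∀ S → CritSucc S w x → CritSucc (extend S) w u
      u-realises S cx = R-trans wx xu , λ E cE →
        let n = proj₁ (proj₂ cu _ (lift-critical S cx E cE)) in
        ∋-mp u (tauto {2} (~ (a0 ∣ ~ a1) ⊃ ~ a0) (E ∷ □ (¬' E) ∷ []) refl) n ,
        ∋-mp u (tauto {2} (~ (a0 ∣ ~ a1) ⊃ a1) (E ∷ □ (¬' E) ∷ []) refl) n

      restrict : ∀ S {v} → CritSucc (extend S) w v → CritSucc S w v
      restrict S cv = proj₁ cv , λ E (S0 , s0 , q) → proj₂ cv E (S0 , All.map ∨-true-left s0 , q)

      -- A world realising an extended label contains □¬E for every χ-critical E at x ...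
      inherits-critical : ∀ S {v} → CritSucc (extend S) w v → ∀ E → Critical x χ E → v ∋ □ (¬' E)
      inherits-critical S {v} cv E c = ∋-mp v ¬¬-elim (proj₁ (proj₂ cv (¬' (□ (¬' E)))
        ((□ (¬' E) ∷ []) , ∨-true-right {S (□ (¬' E))} (holds-complete (E , refl , c)) ∷ [] ,
         ∋-thm w (▷-nec (tauto {1} (~ a0 ⊃ (~ a0 ∣ ff)) (□ (¬' E) ∷ []) refl)))))

      -- ... and hence every box of x, as F with x ∋ □F is χ-critical via ¬F ▷ ⊥.
      inherits-boxes : ∀ S {v} → CritSucc (extend S) w v → ∀ F → x ∋ □ F → v ∋ □ F
      inherits-boxes S {v} cv F xF = ∋-mp v (□-mono ¬¬-elim) (inherits-critical S cv (¬' F) ([] , [] , xF))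

      successors-critical : ∀ S {v z} → CritSucc (extend S) w v → R v z → CritSucc χ x z
      successors-critical S {v} cv (mkR vz (E0 , e , zE , vE)) =
        mkR (λ F xF → vz F (inherits-boxes S cv F xF))
            (E0 , e , zE , ¬∋⇒∌ x (λ p → ∋-∌ v (inherits-boxes S cv (¬' E0) p) vE)) ,
        λ E c → vz (¬' E) (inherits-critical S cv E c)

      witness : ∀ (C : MCS → Set) → (∀ z → CritSucc χ x z → C z) →
                Σ (MCS → Set) λ U → (∀ y → U y → V y) × SC w x U × (∀ y → R[_] frame U y → C y)
      witness C χ⊆C = U , (λ y → proj₁) , (wx , (λ y q → proj₁ (proj₂ sV) y (proj₁ q)) , realise) ,
                      λ { y (v , Uv , r) → proj₂ Uv y r }
        where
        U : MCS → Set
        U y = V y × (∀ z → R y z → C z)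
        realise : ∀ S → CritSucc S w x → Σ MCS λ v → U v × CritSucc S w v
        realise S cx with proj₂ (proj₂ sV) (extend S) (u-realises S cx)
        ... | v , Vv , cv = v , (Vv , λ z r → χ⊆C z (successors-critical S cv r)) , restrict S cv

    rgen : Rgen frame
    rgen w x u V wx xu sV C C∈𝒞 with labelFor𝒞 x u xu C C∈𝒞
    ... | χ , cu , χ⊆C = RgenWitness.witness w x u V wx xu sV χ cu C χ⊆C

  complete : ∀ (A : Fm) → (∀ (F : GVFrame) → Rgen F → ValidOn F A) → ILR⊢ A
  complete A valid with dec (⊢ A)
  ... | yes ⊢A = ⊢A
  ... | no ⊬A with refuting-MCS ⊬A
  ... | w , w∋¬A = ⊥-elim (∋-contra w w∋A w∋¬A)
    where
    open Canonical (subformulas A)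
    w∋A : w ∋ A
    w∋A = proj₂ (truth A (covered A (λ q → q)) w) (valid frame rgen val w)

mainTheorem2 : ExcludedMiddle (lsuc 0ℓ) →
    ∀ (A : Fm) → (∀ (F : GVFrame) → Rgen F → ValidOn F A) → ILR⊢ A
mainTheorem2 lem = Classical.complete lem
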